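{- The graphs $K_3+K_2$ and $K_3$ are $q$-equivalent for all integers $q\ge 3$.
   Context: All graphs are finite and simple. $G+H$ denotes the vertex-disjoint union of $G$ and $H$; so $K_3+K_2$ is a triangle together with a disjoint edge. For an integer $q\ge 2$, a graph $G$ is $q$-Ramsey for $H$ if every colouring of $E(G)$ with $q$ colours contains a monochromatic copy of $H$; $G$ is $q$-Ramsey-minimal for $H$ if it is $q$-Ramsey for $H$ but no proper subgraph of $G$ is; $\mathcal{M}_q(H)$ is the set of all $q$-Ramsey-minimal graphs for $H$. Two graphs $H,H'$ are $q$-equivalent if $\mathcal{M}_q(H)=\mathcal{M}_q(H')$. -}

module Defs where

open import Data.Nat using (ℕ; zero; suc; _≥_)
open import Data.Fin using (Fin; zero; suc; _≟_)
open import Data.Bool using (Bool; true; false; not)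
open import Data.Product using (Σ; ∃; _×_; _,_)
open import Data.Sum using (_⊎_)
open import Relation.Nullary using (¬_)
open import Relation.Nullary.Decidable using (⌊_⌋)
open import Relation.Binary.PropositionalEquality using (_≡_; refl)
open import Function.Definitions using (Injective; Surjective)

record Graph : Set where
  field
    n      : ℕ
    adj    : Fin n → Fin n → Bool
    sym    : ∀ u v → adj u v ≡ adj v u
    irrefl : ∀ u → adj u u ≡ false

open Graph public

Edge : (G : Graph) → Fin (n G) → Fin (n G) → Set
Edge G u v = adj G u v ≡ true

record Copy (H G : Graph) : Set where
  field
    f      : Fin (n H) → Fin (n G)
    inj    : Injective _≡_ _≡_ f
    edges  : ∀ x y → Edge H x y → Edge G (f x) (f y)

open Copy public

-- A q-colouring of E(G): a colour for each (ordered) pair, required to be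
-- symmetric on edges, so that it is a colouring of the (unordered) edges.
record Colouring (q : ℕ) (G : Graph) : Set where
  field
    col    : Fin (n G) → Fin (n G) → Fin q
    colSym : ∀ u v → Edge G u v → col u v ≡ col v u

open Colouring public

MonoCopy : {q : ℕ} (H G : Graph) → Colouring q G → Set
MonoCopy {q} H G c =
  Σ (Copy H G) λ φ → Σ (Fin q) λ i →
    ∀ x y → Edge H x y → col c (f φ x) (f φ y) ≡ i

IsRamsey : ℕ → Graph → Graph → Set
IsRamsey q H G = (c : Colouring q G) → MonoCopy H G c

-- G' is (isomorphic to) a proper subgraph of G: a copy of G' in G that
-- either misses a vertex or misses an edge of G.
ProperSubgraph : Graph → Graph → Set
ProperSubgraph G' G =
  Σ (Copy G' G) λ φ →
    (¬ Surjective _≡_ _≡_ (f φ))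
    ⊎ (Σ (Fin (n G)) λ u → Σ (Fin (n G)) λ v → Edge G u v ×
         (∀ x y → Edge G' x y → ¬ ((f φ x ≡ u) × (f φ y ≡ v))))

IsRamseyMinimal : ℕ → Graph → Graph → Set
IsRamseyMinimal q H G =
  IsRamsey q H G × (∀ G' → ProperSubgraph G' G → ¬ IsRamsey q H G')

QEquivalent : ℕ → Graph → Graph → Set
QEquivalent q H H' =
  ∀ G → (IsRamseyMinimal q H G → IsRamseyMinimal q H' G)
      × (IsRamseyMinimal q H' G → IsRamseyMinimal q H G)

K3 : Graph
K3 = record
  { n = 3
  ; adj = λ u v → not ⌊ u ≟ v ⌋
  ; sym = k3sym
  ; irrefl = k3irr
  }
  where
  k3sym : ∀ (u v : Fin 3) → not ⌊ u ≟ v ⌋ ≡ not ⌊ v ≟ u ⌋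
  k3sym zero zero = refl
  k3sym zero (suc zero) = refl
  k3sym zero (suc (suc zero)) = refl
  k3sym (suc zero) zero = refl
  k3sym (suc zero) (suc zero) = refl
  k3sym (suc zero) (suc (suc zero)) = refl
  k3sym (suc (suc zero)) zero = refl
  k3sym (suc (suc zero)) (suc zero) = refl
  k3sym (suc (suc zero)) (suc (suc zero)) = refl
  k3irr : ∀ (u : Fin 3) → not ⌊ u ≟ u ⌋ ≡ false
  k3irr zero = refl
  k3irr (suc zero) = refl
  k3irr (suc (suc zero)) = refl

-- K₃ + K₂: vertices 0,1,2 form a triangle, 3–4 is a disjoint edge.
k3k2adj : Fin 5 → Fin 5 → Bool
k3k2adj zero zero = false
k3k2adj zero (suc zero) = true
k3k2adj zero (suc (suc zero)) = true
k3k2adj zero (suc (suc (suc zero))) = false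
k3k2adj zero (suc (suc (suc (suc zero)))) = false
k3k2adj (suc zero) zero = true
k3k2adj (suc zero) (suc zero) = false
k3k2adj (suc zero) (suc (suc zero)) = true
k3k2adj (suc zero) (suc (suc (suc zero))) = false
k3k2adj (suc zero) (suc (suc (suc (suc zero)))) = false
k3k2adj (suc (suc zero)) zero = true
k3k2adj (suc (suc zero)) (suc zero) = true
k3k2adj (suc (suc zero)) (suc (suc zero)) = false
k3k2adj (suc (suc zero)) (suc (suc (suc zero))) = false
k3k2adj (suc (suc zero)) (suc (suc (suc (suc zero)))) = false
k3k2adj (suc (suc (suc zero))) zero = false
k3k2adj (suc (suc (suc zero))) (suc zero) = false
k3k2adj (suc (suc (suc zero))) (suc (suc zero)) = false
k3k2adj (suc (suc (suc zero))) (suc (suc (suc zero))) = false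
k3k2adj (suc (suc (suc zero))) (suc (suc (suc (suc zero)))) = true
k3k2adj (suc (suc (suc (suc zero)))) zero = false
k3k2adj (suc (suc (suc (suc zero)))) (suc zero) = false
k3k2adj (suc (suc (suc (suc zero)))) (suc (suc zero)) = false
k3k2adj (suc (suc (suc (suc zero)))) (suc (suc (suc zero))) = true
k3k2adj (suc (suc (suc (suc zero)))) (suc (suc (suc (suc zero)))) = false

k3k2sym : ∀ u v → k3k2adj u v ≡ k3k2adj v u
k3k2sym zero zero = refl
k3k2sym zero (suc zero) = refl
k3k2sym zero (suc (suc zero)) = refl
k3k2sym zero (suc (suc (suc zero))) = refl
k3k2sym zero (suc (suc (suc (suc zero)))) = refl
k3k2sym (suc zero) zero = refl
k3k2sym (suc zero) (suc zero) = refl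
k3k2sym (suc zero) (suc (suc zero)) = refl
k3k2sym (suc zero) (suc (suc (suc zero))) = refl
k3k2sym (suc zero) (suc (suc (suc (suc zero)))) = refl
k3k2sym (suc (suc zero)) zero = refl
k3k2sym (suc (suc zero)) (suc zero) = refl
k3k2sym (suc (suc zero)) (suc (suc zero)) = refl
k3k2sym (suc (suc zero)) (suc (suc (suc zero))) = refl
k3k2sym (suc (suc zero)) (suc (suc (suc (suc zero)))) = refl
k3k2sym (suc (suc (suc zero))) zero = refl
k3k2sym (suc (suc (suc zero))) (suc zero) = refl
k3k2sym (suc (suc (suc zero))) (suc (suc zero)) = refl
k3k2sym (suc (suc (suc zero))) (suc (suc (suc zero))) = refl
k3k2sym (suc (suc (suc zero))) (suc (suc (suc (suc zero)))) = refl
k3k2sym (suc (suc (suc (suc zero)))) zero = refl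
k3k2sym (suc (suc (suc (suc zero)))) (suc zero) = refl
k3k2sym (suc (suc (suc (suc zero)))) (suc (suc zero)) = refl
k3k2sym (suc (suc (suc (suc zero)))) (suc (suc (suc zero))) = refl
k3k2sym (suc (suc (suc (suc zero)))) (suc (suc (suc (suc zero)))) = refl

k3k2irr : ∀ u → k3k2adj u u ≡ false
k3k2irr zero = refl
k3k2irr (suc zero) = refl
k3k2irr (suc (suc zero)) = refl
k3k2irr (suc (suc (suc zero))) = refl
k3k2irr (suc (suc (suc (suc zero)))) = refl

K3+K2 : Graph
K3+K2 = record { n = 5 ; adj = k3k2adj ; sym = k3k2sym ; irrefl = k3k2irr }

-- If G is q-Ramsey for K₃ it is q-Ramsey for K₃+K₂ (the converse is immediate, as
-- K₃ ⊆ K₃+K₂); so the two graphs have the same Ramsey graphs and hence the same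
-- minimal ones. Take a q-colouring of G in which no colour b has a monochromatic
-- triangle together with a disjoint edge of colour b. Fix a triangle T_b of colour b
-- for every colour that has one, and recolour: an edge between two corners of fixed
-- triangles is coloured by a colouring κ of the complete graph on the 3q corners
-- that has no monochromatic triangle and never uses colour b inside T_b (such κ
-- exists for q ≥ 3); an edge from a corner of T_b to a vertex lying on no fixed
-- triangle gets colour b; every other edge keeps its colour. The new colouring has
-- no monochromatic triangle, which is impossible.
module Submission where

open import Defs hiding (sym)
open import Data.Bool using (Bool; true; false; not; if_then_else_)
open import Data.Bool.Properties using () renaming (_≟_ to _≟ᵇ_)
open import Data.Empty using (⊥; ⊥-elim)
open import Data.Fin using (Fin; zero; suc; toℕ; _↑ˡ_; splitAt; join; _≟_)
open import Data.Fin.Properties using (any?; all?; suc-injective; ↑ˡ-injective; join-splitAt)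
open import Data.Maybe using (Maybe; just; nothing)
open import Data.Maybe.Properties using (just-injective) renaming (≡-dec to ≡-decᵐ)
open import Data.Nat using (ℕ; zero; suc; _+_; _*_; _≥_; s≤s)
open import Data.Nat.DivMod using (_mod_)
open import Data.Product using (Σ; ∃; _×_; _,_; proj₁; proj₂; map₁)
open import Data.Product.Properties using () renaming (≡-dec to ≡-decˣ)
open import Data.Sum using (_⊎_; inj₁; inj₂; [_,_]′)
open import Data.Vec using (_∷_; []; lookup)
open import Function using (_∘_; id)
open import Function.Definitions using (Injective)
open import Relation.Nullary using (¬_; Dec; yes; no)
open import Relation.Nullary.Decidable
  using (⌊_⌋; toWitness; ¬?; _×-dec_; _→-dec_)
open import Relation.Binary.PropositionalEquality
  using (_≡_; _≢_; refl; sym; trans; cong; module ≡-Reasoning)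

_∘ᶜ_ : {F H G : Graph} → Copy H G → Copy F H → Copy F G
ψ ∘ᶜ φ = record
  { f = f ψ ∘ f φ
  ; inj = inj φ ∘ inj ψ
  ; edges = λ x y → edges ψ (f φ x) (f φ y) ∘ edges φ x y
  }

MonoCopy-∘ᶜ : {F H G : Graph} {q : ℕ} {c : Colouring q G} →
  MonoCopy H G c → Copy F H → MonoCopy F G c
MonoCopy-∘ᶜ (ψ , i , mono) φ = ψ ∘ᶜ φ , i , λ x y → mono (f φ x) (f φ y) ∘ edges φ x y

IsRamsey-copy : {q : ℕ} {F H : Graph} → Copy F H → ∀ G → IsRamsey q H G → IsRamsey q F G
IsRamsey-copy φ G R c = MonoCopy-∘ᶜ {c = c} (R c) φ

sameRamsey⇒QEquivalent : {q : ℕ} {H H' : Graph} →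
  (∀ G → IsRamsey q H G → IsRamsey q H' G) → (∀ G → IsRamsey q H' G → IsRamsey q H G) →
  QEquivalent q H H'
sameRamsey⇒QEquivalent {q} to from G = transfer to from , transfer from to
  where
  transfer : ∀ {H H'} → (∀ G → IsRamsey q H G → IsRamsey q H' G) →
    (∀ G → IsRamsey q H' G → IsRamsey q H G) → IsRamseyMinimal q H G → IsRamseyMinimal q H' G
  transfer to from (R , minimal) = to G R , λ G' sub R' → minimal G' sub (from G' R')

Edge? : (G : Graph) → ∀ u v → Dec (Edge G u v)
Edge? G u v = adj G u v ≟ᵇ true

Edge⇒≢ : (G : Graph) {u v : Fin (n G)} → Edge G u v → u ≢ v
Edge⇒≢ G {u} e refl with () ← trans (sym e) (irrefl G u)

Complete : ℕ → Graph
Complete k = record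
  { n = k
  ; adj = λ u v → not ⌊ u ≟ v ⌋
  ; sym = λ u v → cong not (⌊≟⌋-sym u v)
  ; irrefl = λ u → cong not (⌊≟⌋-refl u)
  }
  where
  ⌊≟⌋-sym : (u v : Fin k) → ⌊ u ≟ v ⌋ ≡ ⌊ v ≟ u ⌋
  ⌊≟⌋-sym u v with u ≟ v | v ≟ u
  ... | yes _   | yes _   = refl
  ... | no _    | no _    = refl
  ... | yes u≡v | no v≢u  = ⊥-elim (v≢u (sym u≡v))
  ... | no u≢v  | yes v≡u = ⊥-elim (u≢v (sym v≡u))
  ⌊≟⌋-refl : (u : Fin k) → ⌊ u ≟ u ⌋ ≡ true
  ⌊≟⌋-refl u with u ≟ u
  ... | yes _   = refl
  ... | no u≢u  = ⊥-elim (u≢u refl)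

sumAdj : {A B : Set} → (A → A → Bool) → (B → B → Bool) → A ⊎ B → A ⊎ B → Bool
sumAdj adjA adjB (inj₁ u) (inj₁ v) = adjA u v
sumAdj adjA adjB (inj₂ u) (inj₂ v) = adjB u v
sumAdj adjA adjB _ _ = false

_⊕_ : Graph → Graph → Graph
H ⊕ H' = record
  { n = n H + n H'
  ; adj = λ u v → sumAdj (adj H) (adj H') (splitAt (n H) u) (splitAt (n H) v)
  ; sym = λ u v → sumAdj-sym (splitAt (n H) u) (splitAt (n H) v)
  ; irrefl = λ u → sumAdj-irrefl (splitAt (n H) u)
  }
  where
  sumAdj-sym : ∀ s t → sumAdj (adj H) (adj H') s t ≡ sumAdj (adj H) (adj H') t s
  sumAdj-sym (inj₁ u) (inj₁ v) = Graph.sym H u v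
  sumAdj-sym (inj₁ u) (inj₂ v) = refl
  sumAdj-sym (inj₂ u) (inj₁ v) = refl
  sumAdj-sym (inj₂ u) (inj₂ v) = Graph.sym H' u v
  sumAdj-irrefl : ∀ s → sumAdj (adj H) (adj H') s s ≡ false
  sumAdj-irrefl (inj₁ u) = irrefl H u
  sumAdj-irrefl (inj₂ u) = irrefl H' u

Preserves : (H : Graph) {V : Set} → (V → V → Set) → (Fin (n H) → V) → Set
Preserves H R g = ∀ x y → Edge H x y → R (g x) (g y)

copair : (H H' : Graph) {V : Set} → (Fin (n H) → V) → (Fin (n H') → V) → Fin (n (H ⊕ H')) → V
copair H H' g g' = [ g , g' ]′ ∘ splitAt (n H)

module _ {H H' : Graph} {V : Set} {g : Fin (n H) → V} {g' : Fin (n H') → V} where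

  ⊕-preserves : {R : V → V → Set} → Preserves H R g → Preserves H' R g' →
    Preserves (H ⊕ H') R (copair H H' g g')
  ⊕-preserves pg pg' x y e with splitAt (n H) x | splitAt (n H) y
  ⊕-preserves pg pg' x y e  | inj₁ a | inj₁ b = pg a b e
  ⊕-preserves pg pg' x y () | inj₁ a | inj₂ b
  ⊕-preserves pg pg' x y () | inj₂ a | inj₁ b
  ⊕-preserves pg pg' x y e  | inj₂ a | inj₂ b = pg' a b e

  ⊕-injective : Injective _≡_ _≡_ g → Injective _≡_ _≡_ g' → (∀ a b → g a ≢ g' b) →
    Injective _≡_ _≡_ (copair H H' g g')
  ⊕-injective ig ig' disjoint {x} {y} e = begin
    x                       ≡⟨ sym (join-splitAt (n H) (n H') x) ⟩
    join′ (splitAt (n H) x) ≡⟨ cong join′ (copair-injective (splitAt (n H) x) (splitAt (n H) y) e) ⟩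
    join′ (splitAt (n H) y) ≡⟨ join-splitAt (n H) (n H') y ⟩
    y                       ∎
    where
    open ≡-Reasoning
    join′ = join (n H) (n H')
    copair-injective : ∀ s t → [ g , g' ]′ s ≡ [ g , g' ]′ t → s ≡ t
    copair-injective (inj₁ a) (inj₁ b) e = cong inj₁ (ig e)
    copair-injective (inj₁ a) (inj₂ b) e = ⊥-elim (disjoint a b e)
    copair-injective (inj₂ a) (inj₁ b) e = ⊥-elim (disjoint b a (sym e))
    copair-injective (inj₂ a) (inj₂ b) e = cong inj₂ (ig' e)

K3↪K3+K2 : Copy K3 K3+K2
K3↪K3+K2 = record
  { f = _↑ˡ 2
  ; inj = ↑ˡ-injective 2 _ _
  ; edges = toWitness {a? = all? λ x → all? λ y →
      Edge? K3 x y →-dec Edge? K3+K2 (x ↑ˡ 2) (y ↑ˡ 2)} _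
  }

K3+K2↪K3⊕K2 : Copy K3+K2 (Complete 3 ⊕ Complete 2)
K3+K2↪K3⊕K2 = record
  { f = id
  ; inj = id
  ; edges = toWitness {a? = all? λ x → all? λ y →
      Edge? K3+K2 x y →-dec Edge? (Complete 3 ⊕ Complete 2) x y} _
  }

triangle : {V : Set} → V → V → V → Fin 3 → V
triangle x y z = lookup (x ∷ y ∷ z ∷ [])

segment : {V : Set} → V → V → Fin 2 → V
segment u v = lookup (u ∷ v ∷ [])

Disjoint : {V : Set} {k l : ℕ} → (Fin k → V) → (Fin l → V) → Set
Disjoint g g' = ∀ i j → g i ≢ g' j

module _ {q : ℕ} {G : Graph} (c : Colouring q G) where

  private
    V = Fin (n G)

  ColouredEdge : Fin q → V → V → Set
  ColouredEdge b u v = Edge G u v × col c u v ≡ b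

  ColouredEdge-sym : ∀ {b u v} → ColouredEdge b u v → ColouredEdge b v u
  ColouredEdge-sym {u = u} {v} (e , cuv) =
    trans (Graph.sym G v u) e , trans (sym (colSym c u v e)) cuv

  MonoClique : {k : ℕ} → Fin q → (Fin k → V) → Set
  MonoClique b g = ∀ i j → i ≢ j → ColouredEdge b (g i) (g j)

  MonoClique? : {k : ℕ} (b : Fin q) (g : Fin k → V) → Dec (MonoClique b g)
  MonoClique? b g = all? λ i → all? λ j →
    ¬? (i ≟ j) →-dec (Edge? G (g i) (g j) ×-dec (col c (g i) (g j) ≟ b))

  MonoClique⇒injective : ∀ {k b} {g : Fin k → V} → MonoClique b g → Injective _≡_ _≡_ g
  MonoClique⇒injective clique {i} {j} gi≡gj with i ≟ j
  ... | yes i≡j = i≡j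
  ... | no i≢j  = ⊥-elim (Edge⇒≢ G (proj₁ (clique i j i≢j)) gi≡gj)

  MonoClique⇒preserves : ∀ {k b} {g : Fin k → V} → MonoClique b g →
    Preserves (Complete k) (ColouredEdge b) g
  MonoClique⇒preserves {k} clique i j e = clique i j (Edge⇒≢ (Complete k) e)

  MonoCopy-from : ∀ {H b} {g : Fin (n H) → V} →
    Injective _≡_ _≡_ g → Preserves H (ColouredEdge b) g → MonoCopy H G c
  MonoCopy-from {b = b} {g} g-inj g-pres =
    record { f = g ; inj = g-inj ; edges = λ x y → proj₁ ∘ g-pres x y } ,
    b , λ x y → proj₂ ∘ g-pres x y

  segment-clique : ∀ {b u v} → ColouredEdge b u v → MonoClique b (segment u v)
  segment-clique e zero       zero       0≢0 = ⊥-elim (0≢0 refl)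
  segment-clique e zero       (suc zero) _   = e
  segment-clique e (suc zero) zero       _   = ColouredEdge-sym e
  segment-clique e (suc zero) (suc zero) 1≢1 = ⊥-elim (1≢1 refl)

  triangle-clique : ∀ {b x y z} → ColouredEdge b x y → ColouredEdge b x z → ColouredEdge b y z →
    MonoClique b (triangle x y z)
  triangle-clique exy exz eyz zero             (suc zero)       _ = exy
  triangle-clique exy exz eyz zero             (suc (suc zero)) _ = exz
  triangle-clique exy exz eyz (suc zero)       (suc (suc zero)) _ = eyz
  triangle-clique exy exz eyz (suc zero)       zero             _ = ColouredEdge-sym exy
  triangle-clique exy exz eyz (suc (suc zero)) zero             _ = ColouredEdge-sym exz
  triangle-clique exy exz eyz (suc (suc zero)) (suc zero)       _ = ColouredEdge-sym eyz
  triangle-clique exy exz eyz zero             zero             i≢i = ⊥-elim (i≢i refl)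
  triangle-clique exy exz eyz (suc zero)       (suc zero)       i≢i = ⊥-elim (i≢i refl)
  triangle-clique exy exz eyz (suc (suc zero)) (suc (suc zero)) i≢i = ⊥-elim (i≢i refl)

  MonoTriangle : Fin q → Set
  MonoTriangle b = ∃ λ x → ∃ λ y → ∃ λ z → MonoClique b (triangle x y z)

  MonoTriangle? : (b : Fin q) → Dec (MonoTriangle b)
  MonoTriangle? b = any? λ x → any? λ y → any? λ z → MonoClique? b (triangle x y z)

  TriangleAndEdge : Set
  TriangleAndEdge = ∃ λ b → ∃ λ x → ∃ λ y → ∃ λ z → ∃ λ u → ∃ λ v →
    MonoClique b (triangle x y z) × MonoClique b (segment u v) ×
    Disjoint (triangle x y z) (segment u v)

  TriangleAndEdge? : Dec TriangleAndEdge
  TriangleAndEdge? = any? λ b → any? λ x → any? λ y → any? λ z → any? λ u → any? λ v →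
    MonoClique? b (triangle x y z) ×-dec (MonoClique? b (segment u v) ×-dec
    (all? λ i → all? λ j → ¬? (triangle x y z i ≟ segment u v j)))

  TriangleAndEdge⇒MonoCopy : TriangleAndEdge → MonoCopy K3+K2 G c
  TriangleAndEdge⇒MonoCopy (b , x , y , z , u , v , t , e , disjoint) =
    MonoCopy-∘ᶜ {c = c} (MonoCopy-from {b = b} copy-injective copy-preserves) K3+K2↪K3⊕K2
    where
    copy : Fin 5 → V
    copy = copair (Complete 3) (Complete 2) (triangle x y z) (segment u v)
    copy-injective : Injective _≡_ _≡_ copy
    copy-injective = ⊕-injective {Complete 3} {Complete 2}
      (MonoClique⇒injective t) (MonoClique⇒injective e) disjoint
    copy-preserves : Preserves (Complete 3 ⊕ Complete 2) (ColouredEdge b) copy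
    copy-preserves = ⊕-preserves {Complete 3} {Complete 2} {R = ColouredEdge b}
      (MonoClique⇒preserves t) (MonoClique⇒preserves e)

Corner : ℕ → Set
Corner q = Fin q × Fin 3

_≟ᶜ_ : {q : ℕ} (p p' : Corner q) → Dec (p ≡ p')
_≟ᶜ_ = ≡-decˣ _≟_ _≟_

AllEqual : {A : Set} → A → A → A → Set
AllEqual a b c = a ≡ b × a ≡ c

TriangleFree : {A C : Set} → (A → A → C) → Set
TriangleFree κ = ∀ {a₁ a₂ a₃} → a₁ ≢ a₂ → a₁ ≢ a₃ → a₂ ≢ a₃ → ¬ AllEqual (κ a₁ a₂) (κ a₁ a₃) (κ a₂ a₃)

record CornerColouring (q : ℕ) : Set where
  field
    κ               : Corner q → Corner q → Fin q
    κ-sym           : ∀ p p' → κ p p' ≡ κ p' p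
    κ-own           : ∀ b {i j} → i ≢ j → κ (b , i) (b , j) ≢ b
    κ-triangle-free : TriangleFree κ

cornerColouring₃ : CornerColouring 3
cornerColouring₃ = record
  { κ = κ₃
  ; κ-sym = λ { (g , i) (h , j) → κ₃-sym g i h j }
  ; κ-own = λ b {i} {j} → κ₃-own b i j
  ; κ-triangle-free = λ { {g₁ , i₁} {g₂ , i₂} {g₃ , i₃} → κ₃-triangle-free g₁ i₁ g₂ i₂ g₃ i₃ }
  }
  where
  -- Over ℤ/3: g + 2 + ij inside block g, and gh + (g − h)(i − j) between blocks g ≠ h,
  -- with (g − h)(i − j) written as (g + 2h)(i + 2j) to avoid truncated subtraction.
  κ₃ : Corner 3 → Corner 3 → Fin 3
  κ₃ (g , i) (h , j) =
    (if ⌊ g ≟ h ⌋ then 2 + g' + i' * j' else g' * h' + (g' + 2 * h') * (i' + 2 * j')) mod 3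
    where
    g' = toℕ g
    h' = toℕ h
    i' = toℕ i
    j' = toℕ j
  κ₃-sym : ∀ g i h j → κ₃ (g , i) (h , j) ≡ κ₃ (h , j) (g , i)
  κ₃-sym = toWitness {a? = all? λ g → all? λ i → all? λ h → all? λ j →
    κ₃ (g , i) (h , j) ≟ κ₃ (h , j) (g , i)} _
  κ₃-own : ∀ b i j → i ≢ j → κ₃ (b , i) (b , j) ≢ b
  κ₃-own = toWitness {a? = all? λ b → all? λ i → all? λ j →
    ¬? (i ≟ j) →-dec ¬? (κ₃ (b , i) (b , j) ≟ b)} _
  κ₃-triangle-free : ∀ g₁ i₁ g₂ i₂ g₃ i₃ → let p₁ = g₁ , i₁ ; p₂ = g₂ , i₂ ; p₃ = g₃ , i₃ in
    p₁ ≢ p₂ → p₁ ≢ p₃ → p₂ ≢ p₃ → ¬ AllEqual (κ₃ p₁ p₂) (κ₃ p₁ p₃) (κ₃ p₂ p₃)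
  κ₃-triangle-free = toWitness {a? =
    all? λ g₁ → all? λ i₁ → all? λ g₂ → all? λ i₂ → all? λ g₃ → all? λ i₃ →
    let p₁ = g₁ , i₁ ; p₂ = g₂ , i₂ ; p₃ = g₃ , i₃ in
    ¬? (p₁ ≟ᶜ p₂) →-dec (¬? (p₁ ≟ᶜ p₃) →-dec (¬? (p₂ ≟ᶜ p₃) →-dec
    ¬? ((κ₃ p₁ p₂ ≟ κ₃ p₁ p₃) ×-dec (κ₃ p₁ p₂ ≟ κ₃ p₂ p₃))))} _

-- The new triangle (block 0) is joined to every old corner in the new colour 0,
-- so colour 0 spans a bipartite graph; inside the new triangle only colours 1 and 2 occur.
extend : {q : ℕ} → CornerColouring (2 + q) → CornerColouring (3 + q)
extend {q} K = record
  { κ = κ'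
  ; κ-sym = κ'-sym
  ; κ-own = κ'-own
  ; κ-triangle-free = κ'-triangle-free
  }
  where
  open CornerColouring K

  newBlock : Fin 3 → Fin 3 → Fin (2 + q)
  newBlock zero _    = zero
  newBlock _    zero = zero
  newBlock _    _    = suc zero

  newBlock-sym : ∀ i j → newBlock i j ≡ newBlock j i
  newBlock-sym zero    zero    = refl
  newBlock-sym zero    (suc _) = refl
  newBlock-sym (suc _) zero    = refl
  newBlock-sym (suc _) (suc _) = refl

  newBlock-triangle-free : TriangleFree newBlock
  newBlock-triangle-free {i₁} {i₂} {i₃} = toWitness {a? =
    all? λ i₁ → all? λ i₂ → all? λ i₃ →
    ¬? (i₁ ≟ i₂) →-dec (¬? (i₁ ≟ i₃) →-dec (¬? (i₂ ≟ i₃) →-dec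
    ¬? ((newBlock i₁ i₂ ≟ newBlock i₁ i₃) ×-dec (newBlock i₁ i₂ ≟ newBlock i₂ i₃))))} _ i₁ i₂ i₃

  κ' : Corner (3 + q) → Corner (3 + q) → Fin (3 + q)
  κ' (zero  , i) (zero  , j) = suc (newBlock i j)
  κ' (zero  , _) (suc _ , _) = zero
  κ' (suc _ , _) (zero  , _) = zero
  κ' (suc g , i) (suc h , j) = suc (κ (g , i) (h , j))

  κ'-sym : ∀ p p' → κ' p p' ≡ κ' p' p
  κ'-sym (zero  , i) (zero  , j) = cong suc (newBlock-sym i j)
  κ'-sym (zero  , _) (suc _ , _) = refl
  κ'-sym (suc _ , _) (zero  , _) = refl
  κ'-sym (suc g , i) (suc h , j) = cong suc (κ-sym (g , i) (h , j))

  κ'-own : ∀ b {i j} → i ≢ j → κ' (b , i) (b , j) ≢ b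
  κ'-own zero    _   ()
  κ'-own (suc b) i≢j = κ-own b i≢j ∘ suc-injective

  κ'-triangle-free : TriangleFree κ'
  κ'-triangle-free {zero , _} {zero , _} {zero , _} p₁₂ p₁₃ p₂₃ (e , e') =
    newBlock-triangle-free (p₁₂ ∘ cong (zero ,_)) (p₁₃ ∘ cong (zero ,_)) (p₂₃ ∘ cong (zero ,_))
      (suc-injective e , suc-injective e')
  κ'-triangle-free {zero  , _} {zero  , _} {suc _ , _} _ _ _ (() , _)
  κ'-triangle-free {zero  , _} {suc _ , _} {zero  , _} _ _ _ (() , _)
  κ'-triangle-free {zero  , _} {suc _ , _} {suc _ , _} _ _ _ (_ , ())
  κ'-triangle-free {suc _ , _} {zero  , _} {zero  , _} _ _ _ (_ , ())
  κ'-triangle-free {suc _ , _} {zero  , _} {suc _ , _} _ _ _ (() , _)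
  κ'-triangle-free {suc _ , _} {suc _ , _} {zero  , _} _ _ _ (() , _)
  κ'-triangle-free {suc _ , _} {suc _ , _} {suc _ , _} p₁₂ p₁₃ p₂₃ (e , e') =
    κ-triangle-free (p₁₂ ∘ cong (map₁ suc)) (p₁₃ ∘ cong (map₁ suc)) (p₂₃ ∘ cong (map₁ suc))
      (suc-injective e , suc-injective e')

cornerColouring : ∀ m → CornerColouring (3 + m)
cornerColouring zero    = cornerColouring₃
cornerColouring (suc m) = extend (cornerColouring m)

module Recolouring {q : ℕ} (K : CornerColouring q) {G : Graph} (c : Colouring q G)
                   (no-triangle-and-edge : ¬ TriangleAndEdge c) where

  open CornerColouring K

  private
    V = Fin (n G)

  cornerOf : ∀ {b} → Dec (MonoTriangle c b) → Fin 3 → Maybe V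
  cornerOf (yes (x , y , z , _)) i = just (triangle x y z i)
  cornerOf (no _)                _ = nothing

  occupant : Corner q → Maybe V
  occupant (b , i) = cornerOf (MonoTriangle? c b) i

  Unplaced : V → Set
  Unplaced u = ∀ p → occupant p ≢ just u

  data Location (u : V) : Maybe (Corner q) → Set where
    at  : ∀ {p} → occupant p ≡ just u → Location u (just p)
    off : Unplaced u → Location u nothing

  locate : (u : V) → Σ (Maybe (Corner q)) (Location u)
  locate u with any? (λ b → any? λ i → ≡-decᵐ _≟_ (occupant (b , i)) (just u))
  ... | yes (b , i , e) = just (b , i) , at e
  ... | no unplaced     = nothing , off λ p e → unplaced (proj₁ p , proj₂ p , e)

  position : V → Maybe (Corner q)
  position = proj₁ ∘ locate

  location : (u : V) → Location u (position u)
  location = proj₂ ∘ locate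

  combine : Maybe (Corner q) → Maybe (Corner q) → Fin q → Fin q
  combine (just p)       (just p')      _ = κ p p'
  combine (just (b , _)) nothing        _ = b
  combine nothing        (just (b , _)) _ = b
  combine nothing        nothing        a = a

  combine-sym : ∀ m m' {a a'} → a ≡ a' → combine m m' a ≡ combine m' m a'
  combine-sym (just p) (just p') _   = κ-sym p p'
  combine-sym (just _) nothing   _   = refl
  combine-sym nothing  (just _)  _   = refl
  combine-sym nothing  nothing   a≡a' = a≡a'

  recolouring : Colouring q G
  recolouring = record
    { col = λ u v → combine (position u) (position v) (col c u v)
    ; colSym = λ u v e → combine-sym (position u) (position v) (colSym c u v e)
    }

  occupied⇒MonoTriangle : ∀ {b i u} → occupant (b , i) ≡ just u → MonoTriangle c b
  occupied⇒MonoTriangle {b} = occupied (MonoTriangle? c b)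
    where
    occupied : ∀ {i u} (d : Dec (MonoTriangle c b)) → cornerOf d i ≡ just u → MonoTriangle c b
    occupied (yes t) _ = t

  unplaced-edge⇒¬MonoTriangle : ∀ {b u v} → Unplaced u → Unplaced v → ColouredEdge c b u v →
    ¬ MonoTriangle c b
  unplaced-edge⇒¬MonoTriangle {b} {u} {v} u-off v-off e =
    avoided (MonoTriangle? c b) (λ i → u-off (b , i)) (λ i → v-off (b , i))
    where
    avoided : (d : Dec (MonoTriangle c b)) →
      (∀ i → cornerOf d i ≢ just u) → (∀ i → cornerOf d i ≢ just v) → ¬ MonoTriangle c b
    avoided (no ¬t) _ _ = ¬t
    avoided (yes (x , y , z , t)) u∉t v∉t _ =
      no-triangle-and-edge (b , x , y , z , u , v , t , segment-clique c e , disjoint)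
      where
      disjoint : Disjoint (triangle x y z) (segment u v)
      disjoint i zero       = u∉t i ∘ cong just
      disjoint i (suc zero) = v∉t i ∘ cong just

  corners-≢ : ∀ {p p' u u'} → occupant p ≡ just u → occupant p' ≡ just u' → u ≢ u' → p ≢ p'
  corners-≢ eu eu' u≢u' refl = u≢u' (just-injective (trans (sym eu) eu'))

  same-block-colour-≢ : ∀ {b b' k k' u u'} →
    occupant (b , k) ≡ just u → occupant (b' , k') ≡ just u' → u ≢ u' →
    b ≡ b' → κ (b , k) (b' , k') ≢ b
  same-block-colour-≢ {b} eu eu' u≢u' refl = κ-own b (corners-≢ eu eu' u≢u' ∘ cong (b ,_))

  no-mono-triangle : ∀ {x y z mx my mz i} → Location x mx → Location y my → Location z mz →
    Edge G x y → Edge G x z → Edge G y z →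
    combine mx my (col c x y) ≡ i → combine mx mz (col c x z) ≡ i →
    combine my mz (col c y z) ≡ i → ⊥
  no-mono-triangle (off x-off) (off y-off) (off _) exy exz eyz cxy cxz cyz =
    unplaced-edge⇒¬MonoTriangle x-off y-off (exy , cxy)
      (_ , _ , _ , triangle-clique c (exy , cxy) (exz , cxz) (eyz , cyz))
  no-mono-triangle (at ex) (off y-off) (off z-off) _ _ eyz cxy _ cyz =
    unplaced-edge⇒¬MonoTriangle y-off z-off (eyz , trans cyz (sym cxy)) (occupied⇒MonoTriangle ex)
  no-mono-triangle (off x-off) (at ey) (off z-off) _ exz _ cxy cxz _ =
    unplaced-edge⇒¬MonoTriangle x-off z-off (exz , trans cxz (sym cxy)) (occupied⇒MonoTriangle ey)
  no-mono-triangle (off x-off) (off y-off) (at ez) exy _ _ cxy cxz _ =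
    unplaced-edge⇒¬MonoTriangle x-off y-off (exy , trans cxy (sym cxz)) (occupied⇒MonoTriangle ez)
  no-mono-triangle (at ex) (at ey) (off _) exy _ _ cxy cxz cyz =
    same-block-colour-≢ ex ey (Edge⇒≢ G exy) (trans cxz (sym cyz)) (trans cxy (sym cxz))
  no-mono-triangle (at ex) (off _) (at ez) _ exz _ cxy cxz cyz =
    same-block-colour-≢ ex ez (Edge⇒≢ G exz) (trans cxy (sym cyz)) (trans cxz (sym cxy))
  no-mono-triangle (off _) (at ey) (at ez) _ _ eyz cxy cxz cyz =
    same-block-colour-≢ ey ez (Edge⇒≢ G eyz) (trans cxy (sym cxz)) (trans cyz (sym cxy))
  no-mono-triangle (at ex) (at ey) (at ez) exy exz eyz cxy cxz cyz =
    κ-triangle-free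
      (corners-≢ ex ey (Edge⇒≢ G exy)) (corners-≢ ex ez (Edge⇒≢ G exz)) (corners-≢ ey ez (Edge⇒≢ G eyz))
      (trans cxy (sym cxz) , trans cxy (sym cyz))

  recolouring-has-no-mono-triangle : ¬ MonoCopy K3 G recolouring
  recolouring-has-no-mono-triangle (φ , i , mono) =
    no-mono-triangle (location x) (location y) (location z)
      (edges φ 0₃ 1₃ refl) (edges φ 0₃ 2₃ refl) (edges φ 1₃ 2₃ refl)
      (mono 0₃ 1₃ refl) (mono 0₃ 2₃ refl) (mono 1₃ 2₃ refl)
    where
    0₃ 1₃ 2₃ : Fin 3
    0₃ = zero
    1₃ = suc zero
    2₃ = suc (suc zero)
    x = f φ 0₃
    y = f φ 1₃
    z = f φ 2₃

IsRamsey-K3⇒IsRamsey-K3+K2 : {q : ℕ} → CornerColouring q →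
  ∀ G → IsRamsey q K3 G → IsRamsey q K3+K2 G
IsRamsey-K3⇒IsRamsey-K3+K2 K G R c with TriangleAndEdge? c
... | yes found = TriangleAndEdge⇒MonoCopy c found
... | no none   = ⊥-elim (recolouring-has-no-mono-triangle (R recolouring))
  where open Recolouring K c none

theorem1p7 : ∀ (q : ℕ) → q ≥ 3 → QEquivalent q K3+K2 K3
theorem1p7 (suc (suc (suc m))) (s≤s (s≤s (s≤s _))) =
  sameRamsey⇒QEquivalent (IsRamsey-copy K3↪K3+K2) (IsRamsey-K3⇒IsRamsey-K3+K2 (cornerColouring m))
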